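{- There are at least two pairwise non-isomorphic Steinitz-Rademacher polyhedra of cardinality 8.
   Context: Let $\pi$ be the unsorted first-order signature with equality consisting of three unary predicates $V$ ("vertex"), $E$ ("edge"), $F$ ("face") and one binary relation $I$ ("incidence"). The theory $\mathsf{SR}$ consists of the following $\pi$-sentences: (1) there is at least one vertex, at least one edge, and at least one face; (2) every element satisfies $V$, $E$, or $F$; (3) $I$ is symmetric; (4) no two vertices are incident with each other, no two edges are incident with each other, and no two faces are incident with each other; (5) for all $v,e,f$, if $V(v)$, $E(e)$, $F(f)$, $I(v,e)$ and $I(e,f)$, then $I(v,f)$; (6) every edge is incident with exactly two vertices; (7) every edge is incident with exactly two faces; (8) whenever $V(v)$, $F(f)$ and $I(v,f)$, there are exactly two edges incident with both $v$ and $f$; (9) every vertex and every face is incident with at least one other element. A Steinitz-Rademacher polyhedron is a $\pi$-structure satisfying all sentences of $\mathsf{SR}$; its cardinality is the cardinality of its domain. -}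

module Defs where

open import Level using (0ℓ)
open import Data.Bool using (Bool; T)
open import Data.Product using (Σ; ∃; _×_)
open import Data.Sum using (_⊎_)
open import Relation.Nullary using (¬_)
open import Relation.Binary.PropositionalEquality using (_≡_; _≢_)
open import Function.Bundles using (_↔_; Inverse)

-- A π-structure on a carrier A: unary predicates V, E, F and binary relation I.
-- (First-order structures are classical, so relations are Bool-valued.)
record πStructure (A : Set) : Set where
  field
    V E F : A → Bool
    I     : A → A → Bool

ExactlyTwo : {A : Set} → (A → Set) → Set
ExactlyTwo {A} P =
  Σ A λ a → Σ A λ b → a ≢ b × P a × P b × (∀ c → P c → c ≡ a ⊎ c ≡ b)

record SR {A : Set} (S : πStructure A) : Set where
  open πStructure S
  field
    ax1-V : ∃ λ v → T (V v)
    ax1-E : ∃ λ e → T (E e)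
    ax1-F : ∃ λ f → T (F f)
    ax2   : ∀ x → T (V x) ⊎ T (E x) ⊎ T (F x)
    ax3   : ∀ x y → T (I x y) → T (I y x)
    ax4-V : ∀ x y → T (V x) → T (V y) → ¬ T (I x y)
    ax4-E : ∀ x y → T (E x) → T (E y) → ¬ T (I x y)
    ax4-F : ∀ x y → T (F x) → T (F y) → ¬ T (I x y)
    ax5   : ∀ v e f → T (V v) → T (E e) → T (F f) →
            T (I v e) → T (I e f) → T (I v f)
    ax6   : ∀ e → T (E e) → ExactlyTwo (λ v → T (V v) × T (I e v))
    ax7   : ∀ e → T (E e) → ExactlyTwo (λ f → T (F f) × T (I e f))
    ax8   : ∀ v f → T (V v) → T (F f) → T (I v f) →
            ExactlyTwo (λ e → T (E e) × T (I v e) × T (I e f))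
    ax9   : ∀ x → T (V x) ⊎ T (F x) → ∃ λ y → y ≢ x × T (I x y)

record _≅_ {A B : Set} (S : πStructure A) (S' : πStructure B) : Set where
  module S  = πStructure S
  module S' = πStructure S'
  field
    bij   : A ↔ B
  open Inverse bij using (to)
  field
    pres-V : ∀ x → S.V x ≡ S'.V (to x)
    pres-E : ∀ x → S.E x ≡ S'.E (to x)
    pres-F : ∀ x → S.F x ≡ S'.F (to x)
    pres-I : ∀ x y → S.I x y ≡ S'.I (to x) (to y)

-- The triangular dihedron (a triangle whose two sides are the two faces) has
-- three vertices and two faces; swapping vertices and faces preserves the
-- axioms of SR, so its dual is again a polyhedron on the same eight elements,
-- now with only two vertices. An isomorphism would inject the three vertices
-- of the first into the two vertices of the second.
module Submission where

open import Defs
open import Data.Bool using (Bool; true; false; T; not; _∨_; _xor_)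
open import Data.Fin using (Fin; toℕ; _↑ˡ_; _↑ʳ_; _≟_)
open import Data.Fin.Properties using (all?; any?; injective⇒≤; ↑ˡ-injective)
open import Data.Nat using (ℕ; _≤_; _<ᵇ_; s≤s)
open import Data.Product using (Σ; ∃; _×_; _,_; proj₁; proj₂)
open import Data.Sum using (_⊎_; inj₁; inj₂; [_,_]′)
open import Function using (_∘_)
open import Function.Bundles using (Injection)
open import Function.Definitions using (Injective)
open import Function.Properties.Inverse using (↔⇒↣)
open import Relation.Nullary using (¬_; Dec)
open import Relation.Nullary.Decidable using (T?; ¬?; _×-dec_; _⊎-dec_; _→-dec_; map′; toWitness)
open import Relation.Binary.PropositionalEquality using (_≡_; sym; trans; cong; subst)

module _ {A : Set} where

  ExactlyTwo-map : {P Q : A → Set} → (∀ x → P x → Q x) → (∀ x → Q x → P x) →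
                   ExactlyTwo P → ExactlyTwo Q
  ExactlyTwo-map P⇒Q Q⇒P (a , b , a≢b , Pa , Pb , only) =
    a , b , a≢b , P⇒Q a Pa , P⇒Q b Pb , λ c → only c ∘ Q⇒P c

  dual : πStructure A → πStructure A
  dual S = record { V = F ; E = E ; F = V ; I = I }
    where open πStructure S

  SR-dual : {S : πStructure A} → SR S → SR (dual S)
  SR-dual {S} sr = record
    { ax1-V = ax1-F
    ; ax1-E = ax1-E
    ; ax1-F = ax1-V
    ; ax2   = λ x → [ inj₂ ∘ inj₂ , [ inj₂ ∘ inj₁ , inj₁ ]′ ]′ (ax2 x)
    ; ax3   = ax3
    ; ax4-V = ax4-F
    ; ax4-E = ax4-E
    ; ax4-F = ax4-V
    ; ax5   = λ f e v Ff Ee Vv Ife Iev →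
                ax3 v f (ax5 v e f Vv Ee Ff (ax3 e v Iev) (ax3 f e Ife))
    ; ax6   = ax7
    ; ax7   = ax6
    ; ax8   = λ f v Ff Vv Ifv →
                ExactlyTwo-map (λ e (Ee , Ive , Ief) → Ee , ax3 e f Ief , ax3 v e Ive)
                               (λ e (Ee , Ife , Iev) → Ee , ax3 e v Iev , ax3 f e Ife)
                               (ax8 v f Vv Ff (ax3 f v Ifv))
    ; ax9   = λ x → ax9 x ∘ [ inj₂ , inj₁ ]′
    }
    where open SR sr; open πStructure S

module _ {A B : Set} {S : πStructure A} {S′ : πStructure B} where
  private
    module S  = πStructure S
    module S′ = πStructure S′

  ≅⇒vertex-count-≤ : S ≅ S′ → {k m : ℕ}
    (vs : Fin k → A) → Injective _≡_ _≡_ vs → (∀ i → T (S.V (vs i))) →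
    (ws : Fin m → B) → (∀ y → T (S′.V y) → ∃ λ j → ws j ≡ y) →
    k ≤ m
  ≅⇒vertex-count-≤ iso {k} {m} vs vs-injective vs-vertices ws ws-cover =
    injective⇒≤ {f = index} index-injective
    where
    open _≅_ iso
    open Injection (↔⇒↣ bij) using (to; injective)
    cover : ∀ i → ∃ λ j → ws j ≡ to (vs i)
    cover i = ws-cover (to (vs i)) (subst T (pres-V (vs i)) (vs-vertices i))
    index : Fin k → Fin m
    index = proj₁ ∘ cover
    index-injective : Injective _≡_ _≡_ index
    index-injective {i} {i′} eq = vs-injective (injective same-image)
      where
      same-image : to (vs i) ≡ to (vs i′)
      same-image = trans (sym (proj₂ (cover i))) (trans (cong ws eq) (proj₂ (cover i′)))

module _ {n : ℕ} (S : πStructure (Fin n)) where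
  open πStructure S

  private
    exactlyTwo? : (P : Fin n → Set) → (∀ x → Dec (P x)) → Dec (ExactlyTwo P)
    exactlyTwo? P P? = any? λ a → any? λ b → ¬? (a ≟ b) ×-dec (P? a ×-dec (P? b ×-dec
                         all? λ c → P? c →-dec ((c ≟ a) ⊎-dec (c ≟ b))))

  SR? : Dec (SR S)
  SR? = map′
    (λ (a1V , a1E , a1F , a2 , a3 , a4V , a4E , a4F , a5 , a6 , a7 , a8 , a9) → record
      { ax1-V = a1V ; ax1-E = a1E ; ax1-F = a1F ; ax2 = a2 ; ax3 = a3
      ; ax4-V = a4V ; ax4-E = a4E ; ax4-F = a4F ; ax5 = a5
      ; ax6 = a6 ; ax7 = a7 ; ax8 = a8 ; ax9 = a9 })
    (λ sr → let open SR sr in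
      ax1-V , ax1-E , ax1-F , ax2 , ax3 , ax4-V , ax4-E , ax4-F , ax5 , ax6 , ax7 , ax8 , ax9)
    ( (any? λ v → T? (V v))
    ×-dec (any? λ e → T? (E e))
    ×-dec (any? λ f → T? (F f))
    ×-dec (all? λ x → T? (V x) ⊎-dec T? (E x) ⊎-dec T? (F x))
    ×-dec (all? λ x → all? λ y → T? (I x y) →-dec T? (I y x))
    ×-dec (all? λ x → all? λ y → T? (V x) →-dec T? (V y) →-dec ¬? (T? (I x y)))
    ×-dec (all? λ x → all? λ y → T? (E x) →-dec T? (E y) →-dec ¬? (T? (I x y)))
    ×-dec (all? λ x → all? λ y → T? (F x) →-dec T? (F y) →-dec ¬? (T? (I x y)))
    ×-dec (all? λ v → all? λ e → all? λ f → T? (V v) →-dec T? (E e) →-dec T? (F f) →-dec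
             T? (I v e) →-dec T? (I e f) →-dec T? (I v f))
    ×-dec (all? λ e → T? (E e) →-dec exactlyTwo? _ λ v → T? (V v) ×-dec T? (I e v))
    ×-dec (all? λ e → T? (E e) →-dec exactlyTwo? _ λ f → T? (F f) ×-dec T? (I e f))
    ×-dec (all? λ v → all? λ f → T? (V v) →-dec T? (F f) →-dec T? (I v f) →-dec
             exactlyTwo? _ λ e → T? (E e) ×-dec T? (I v e) ×-dec T? (I e f))
    ×-dec (all? λ x → (T? (V x) ⊎-dec T? (F x)) →-dec any? λ y → ¬? (y ≟ x) ×-dec T? (I x y)))

-- Vertices 0, 1, 2; edge 3 joins 0 and 1, edge 4 joins 1 and 2, edge 5 joins
-- 2 and 0; faces 6 and 7 are incident with every vertex and edge.
triangularDihedron : πStructure (Fin 8)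
triangularDihedron = record
  { V = isVertex ∘ toℕ
  ; E = isEdge ∘ toℕ
  ; F = isFace ∘ toℕ
  ; I = λ x y → joins (toℕ x) (toℕ y) ∨ joins (toℕ y) (toℕ x) ∨ (isFace (toℕ x) xor isFace (toℕ y))
  }
  where
  isVertex isEdge isFace : ℕ → Bool
  isVertex n = n <ᵇ 3
  isFace   n = 5 <ᵇ n
  isEdge   n = not (isVertex n ∨ isFace n)
  joins : ℕ → ℕ → Bool
  joins 3 0 = true
  joins 3 1 = true
  joins 4 1 = true
  joins 4 2 = true
  joins 5 2 = true
  joins 5 0 = true
  joins _ _ = false

SR-triangularDihedron : SR triangularDihedron
SR-triangularDihedron = toWitness {a? = SR? triangularDihedron} _

module _ where
  open πStructure triangularDihedron

  triangularDihedron-vertices : (i : Fin 3) → T (V (i ↑ˡ 5))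
  triangularDihedron-vertices = toWitness {a? = all? λ i → T? (V (i ↑ˡ 5))} _

  triangularDihedron-faces-covered : ∀ y → T (F y) → ∃ λ (j : Fin 2) → 6 ↑ʳ j ≡ y
  triangularDihedron-faces-covered =
    toWitness {a? = all? λ y → T? (F y) →-dec any? λ j → 6 ↑ʳ j ≟ y} _

triangularDihedron-≇-dual : ¬ (triangularDihedron ≅ dual triangularDihedron)
triangularDihedron-≇-dual iso
  with ≅⇒vertex-count-≤ iso (_↑ˡ 5) (↑ˡ-injective 5 _ _) triangularDihedron-vertices
                            (6 ↑ʳ_) triangularDihedron-faces-covered
... | s≤s (s≤s ())

theorem6 : Σ (πStructure (Fin 8)) λ S₁ → Σ (πStructure (Fin 8)) λ S₂ →
    SR S₁ × SR S₂ × ¬ (S₁ ≅ S₂)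
theorem6 = triangularDihedron , dual triangularDihedron ,
           SR-triangularDihedron , SR-dual SR-triangularDihedron , triangularDihedron-≇-dual
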